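{- Let $G=(V,E)$ be a connected undirected graph with $n=|V|\ge 3$, let $a,b\in V$ be two distinct non-adjacent vertices, and let $\beta(n)$ be an integer with $1\le\beta(n)\le n$. Number the vertices of $V\setminus\{a,b\}$ as $1,\dots,n-2$. Call an ab-separator a partition $\{A,B,C\}$ of $V$ with $a\in A$, $b\in B$, such that $E$ contains no edge $\{i,j\}$ with $i\in A$, $j\in B$, and $\max\{|A|,|B|\}\le\beta(n)$; its incidence vector is $X=(x_{1a},\dots,x_{(n-2)a},x_{1b},\dots,x_{(n-2)b})\in\{0,1\}^{2(n-2)}$ with $x_{ia}=1\iff i\in A$ and $x_{ib}=1\iff i\in B$. Let $P_{ab}$ be the convex hull of the incidence vectors of all ab-separators. For non-adjacent vertices $i,j$, let $\alpha_{ij}$ be the maximum number of internally vertex-disjoint chains (paths) in $G$ between $i$ and $j$. Then for every pair of distinct non-adjacent vertices $i,j\in V\setminus\{a,b\}$, the inequalities $$\sum_{k=1}^{n-2}(x_{ka}+x_{kb})-\alpha_{ij}\,(2-x_{ia}-x_{jb})\le n-\alpha_{ij}$$ and $$\sum_{k=1}^{n-2}(x_{ka}+x_{kb})-\alpha_{ij}\,(2-x_{ja}-x_{ib})\le n-\alpha_{ij}$$ are valid for $P_{ab}$.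
   Formalization: The polytope $P_{ab}$ consists only of its points with rational coordinates, written as convex combinations of separator incidence vectors with rational weights, rather than all real points of the hull. -}

module Defs where

open import Level using (0ℓ)
open import Data.Nat as ℕ using (ℕ; zero; suc)
open import Data.Integer using (+_)
open import Data.Rational as ℚ using (ℚ; 0ℚ; 1ℚ; _/_)
open import Data.Fin using (Fin; zero; suc)
open import Data.Bool using (Bool; true; false; if_then_else_)
open import Data.List using (List; []; _∷_; _++_; map)
open import Data.List.Membership.Propositional using (_∈_)
open import Data.List.Relation.Unary.Linked using (Linked)
open import Data.List.Relation.Unary.Unique.Propositional using (Unique)
open import Data.Product using (Σ; _×_; _,_; ∃)
open import Data.Empty using (⊥)
open import Relation.Nullary using (¬_; Dec; yes; no)
open import Relation.Binary.PropositionalEquality using (_≡_; _≢_)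
open import Relation.Binary.Construct.Closure.ReflexiveTransitive using (Star)

record Graph (n : ℕ) : Set₁ where
  field
    Adj    : Fin n → Fin n → Set
    sym    : ∀ {u v} → Adj u v → Adj v u
    irrefl : ∀ {u} → ¬ Adj u u
open Graph public

Connected : ∀ {n} → Graph n → Set
Connected G = ∀ u v → Star (Adj G) u v

record Path {n} (G : Graph n) (u v : Fin n) : Set where
  field
    interior : List (Fin n)
    chain    : Linked (Adj G) (u ∷ interior ++ v ∷ [])
    simple   : Unique (u ∷ interior ++ v ∷ [])
open Path public

DisjointPaths : ∀ {n} (G : Graph n) (u v : Fin n) (k : ℕ) → Set
DisjointPaths G u v k =
  Σ (Fin k → Path G u v) λ P →
    ∀ p q → p ≢ q → ∀ w → w ∈ interior (P p) → w ∈ interior (P q) → ⊥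

IsMaxDisjointPaths : ∀ {n} (G : Graph n) (u v : Fin n) (α : ℕ) → Set
IsMaxDisjointPaths G u v α =
  DisjointPaths G u v α × (∀ k → DisjointPaths G u v k → k ℕ.≤ α)

data Side : Set where
  inA inB inC : Side

isA : Side → Bool
isA inA = true
isA _   = false

isB : Side → Bool
isB inB = true
isB _   = false

count : ∀ {n} → (Fin n → Bool) → ℕ
count {zero}  f = 0
count {suc n} f = (if f zero then 1 else 0) ℕ.+ count (λ i → f (suc i))

record ABSeparator {n} (G : Graph n) (a b : Fin n) (β : ℕ) : Set where
  field
    side   : Fin n → Side
    a∈A    : side a ≡ inA
    b∈B    : side b ≡ inB
    noEdge : ∀ i j → side i ≡ inA → side j ≡ inB → ¬ Adj G i j
    sizeA  : count (λ v → isA (side v)) ℕ.≤ β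
    sizeB  : count (λ v → isB (side v)) ℕ.≤ β
open ABSeparator public

-- Points of ℚ^{2m}, written as a pair (x_{·a}, x_{·b}) of Fin m → ℚ

Point : ℕ → Set
Point m = (Fin m → ℚ) × (Fin m → ℚ)

ℕ→ℚ : ℕ → ℚ
ℕ→ℚ k = + k / 1

b2q : Bool → ℚ
b2q true  = 1ℚ
b2q false = 0ℚ

incidence : ∀ {n m} {G : Graph n} {a b β} → (Fin m → Fin n) →
            ABSeparator G a b β → Point m
incidence ν S = (λ k → b2q (isA (side S (ν k)))) , (λ k → b2q (isB (side S (ν k))))

sumFin : ∀ {m} → (Fin m → ℚ) → ℚ
sumFin {zero}  f = 0ℚ
sumFin {suc m} f = f zero ℚ.+ sumFin (λ k → f (suc k))

sumList : List ℚ → ℚ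
sumList []       = 0ℚ
sumList (x ∷ xs) = x ℚ.+ sumList xs

-- (rational) convex hull of the incidence vectors of all ab-separators:
-- x ∈ P_ab iff x = Σ λ_t X(S_t) for a finite list of pairs (λ_t, S_t)
-- with λ_t ≥ 0 and Σ λ_t = 1.
InPab : ∀ {n m} (G : Graph n) (a b : Fin n) (β : ℕ) (ν : Fin m → Fin n) →
        Point m → Set
InPab {m = m} G a b β ν (xa , xb) =
  Σ (List (ℚ × ABSeparator G a b β)) λ cs →
    (∀ {l S} → (l , S) ∈ cs → 0ℚ ℚ.≤ l) ×
    sumList (map (λ c → Data.Product.proj₁ c) cs) ≡ 1ℚ ×
    (∀ k → xa k ≡ sumList (map (λ { (l , S) → l ℚ.* Data.Product.proj₁ (incidence ν S) k }) cs)) ×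
    (∀ k → xb k ≡ sumList (map (λ { (l , S) → l ℚ.* Data.Product.proj₂ (incidence ν S) k }) cs))

-- ν : Fin m → Fin n numbers the vertices of V ∖ {a,b} as 1..m (m = n-2)
IsNumbering : ∀ {n m} (a b : Fin n) (ν : Fin m → Fin n) → Set
IsNumbering {n} a b ν =
  (∀ k l → ν k ≡ ν l → k ≡ l) ×
  (∀ k → ν k ≢ a × ν k ≢ b) ×
  (∀ v → v ≢ a → v ≢ b → ∃ λ k → ν k ≡ v)

-- Both inequalities say that the linear form
--   x ↦ Σₖ (x_ka + x_kb) + α (x_pa + x_qb)
-- is at most n + α on P_ab, for (p, q) = (i, j) resp. (j, i); by linearity it suffices
-- to check this at the incidence vector of every ab-separator {A, B, C}. There
-- Σₖ (x_ka + x_kb) = (n − 2) − |C ∖ {a, b}|. If p ∈ A and q ∈ B, each of the α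
-- internally disjoint p–q paths must enter C at an interior vertex, since no edge joins
-- A and B; these vertices are distinct and differ from a and b, so |C ∖ {a, b}| ≥ α and
-- the form is at most (n − 2) − α + 2α. Otherwise x_pa + x_qb ≤ 1 and it is at most
-- (n − 2) + α.
module Submission where

open import Data.Bool using (Bool; true; false; not; if_then_else_)
open import Data.Empty using (⊥-elim)
open import Data.Fin as Fin using (Fin; zero; suc; punchIn; punchOut)
import Data.Fin.Properties as Fin
open import Data.Integer as ℤ using (+_)
import Data.Integer.Properties as ℤ
open import Data.List using (List; []; _∷_; _++_; map)
open import Data.List.Membership.Propositional using (_∈_)
open import Data.List.Relation.Unary.Any using (here; there)
open import Data.List.Relation.Unary.Linked using (Linked; _∷_)
open import Data.Nat as ℕ using (ℕ; zero; suc; z≤n; _≤_)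
import Data.Nat.Properties as ℕ
open import Data.Nat.Coprimality as Coprime using (1-coprimeTo)
open import Data.Product using (_×_; _,_; ∃; proj₁; proj₂)
open import Data.Rational as ℚ using (ℚ; mkℚ; 0ℚ; 1ℚ; _+_; _-_; _*_; -_)
  renaming (_≤_ to _≤ℚ_)
import Data.Rational
import Data.Rational.Properties as ℚ
open import Data.Rational.Solver using (module +-*-Solver)
open import Data.Sum using (_⊎_; inj₁; inj₂; [_,_]; map₁)
open import Function using (_∘_)
open import Relation.Binary.PropositionalEquality
  using (_≡_; _≢_; refl; sym; trans; cong; cong₂; subst; subst₂; module ≡-Reasoning)
open import Relation.Nullary using (¬_; Dec; yes; no)

open import Defs hiding (sym)

private
  ℕ→ℚ-mkℚ : ∀ k → ℕ→ℚ k ≡ mkℚ (+ k) 0 (Coprime.sym (1-coprimeTo k))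
  ℕ→ℚ-mkℚ k = ℚ.↥p/↧p≡p (mkℚ (+ k) 0 (Coprime.sym (1-coprimeTo k)))

ℕ→ℚ-+ : ∀ a b → ℕ→ℚ (a ℕ.+ b) ≡ ℕ→ℚ a + ℕ→ℚ b
ℕ→ℚ-+ a b = begin
  + (a ℕ.+ b) ℚ./ 1                   ≡⟨ ℚ./-cong +[a+b]≡a*1+b*1 refl ⟩
  (+ a ℤ.* + 1 ℤ.+ + b ℤ.* + 1) ℚ./ 1 ≡⟨ sym (cong₂ _+_ (ℕ→ℚ-mkℚ a) (ℕ→ℚ-mkℚ b)) ⟩
  ℕ→ℚ a + ℕ→ℚ b                       ∎
  where
  open ≡-Reasoning
  +[a+b]≡a*1+b*1 : + (a ℕ.+ b) ≡ + a ℤ.* + 1 ℤ.+ + b ℤ.* + 1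
  +[a+b]≡a*1+b*1 =
    trans (ℤ.pos-+ a b) (sym (cong₂ ℤ._+_ (ℤ.*-identityʳ (+ a)) (ℤ.*-identityʳ (+ b))))

ℕ→ℚ-* : ∀ a b → ℕ→ℚ (a ℕ.* b) ≡ ℕ→ℚ a * ℕ→ℚ b
ℕ→ℚ-* a b = begin
  + (a ℕ.* b) ℚ./ 1    ≡⟨ ℚ./-cong (ℤ.pos-* a b) refl ⟩
  (+ a ℤ.* + b) ℚ./ 1  ≡⟨ sym (cong₂ _*_ (ℕ→ℚ-mkℚ a) (ℕ→ℚ-mkℚ b)) ⟩
  ℕ→ℚ a * ℕ→ℚ b        ∎
  where open ≡-Reasoning

ℕ→ℚ-mono-≤ : ∀ {a b} → a ℕ.≤ b → ℕ→ℚ a ≤ℚ ℕ→ℚ b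
ℕ→ℚ-mono-≤ {a} {b} a≤b rewrite ℕ→ℚ-mkℚ a | ℕ→ℚ-mkℚ b =
  ℚ.*≤* (ℤ.*-monoʳ-≤-nonNeg (+ 1) (ℤ.+≤+ a≤b))

indicator : Bool → ℕ
indicator b = if b then 1 else 0

b2q≡ℕ→ℚ-indicator : ∀ b → b2q b ≡ ℕ→ℚ (indicator b)
b2q≡ℕ→ℚ-indicator true  = refl
b2q≡ℕ→ℚ-indicator false = refl

indicator≤1 : ∀ b → indicator b ≤ 1
indicator≤1 true  = ℕ.≤-refl
indicator≤1 false = z≤n

α*indicators≤α : ∀ α b b′ → indicator b ℕ.+ indicator b′ ≤ 1 →
                 α ℕ.* indicator b ℕ.+ α ℕ.* indicator b′ ≤ α
α*indicators≤α α b b′ ≤1 = begin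
  α ℕ.* indicator b ℕ.+ α ℕ.* indicator b′ ≡⟨ ℕ.*-distribˡ-+ α (indicator b) (indicator b′) ⟨
  α ℕ.* (indicator b ℕ.+ indicator b′)     ≤⟨ ℕ.*-monoʳ-≤ α ≤1 ⟩
  α ℕ.* 1                                  ≡⟨ ℕ.*-identityʳ α ⟩
  α                                        ∎
  where open ℕ.≤-Reasoning

count-not+count : ∀ {m} (P : Fin m → Bool) → count (not ∘ P) ℕ.+ count P ≡ m
count-not+count {zero}  P = refl
count-not+count {suc m} P with P zero
... | true  = trans (ℕ.+-suc _ _) (cong suc (count-not+count (P ∘ suc)))
... | false = cong suc (count-not+count (P ∘ suc))

injective⇒≤count : ∀ {m k} (P : Fin m → Bool) (g : Fin k → Fin m) →
  (∀ {x y} → g x ≡ g y → x ≡ y) → (∀ x → P (g x) ≡ true) → k ≤ count P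
injective⇒≤count {zero} {zero}  P g inj hit = z≤n
injective⇒≤count {zero} {suc k} P g inj hit with g zero
... | ()
injective⇒≤count {suc m} {zero}  P g inj hit = z≤n
injective⇒≤count {suc m} {suc k} P g inj hit = split (Fin.any? (λ x → g x Fin.≟ zero))
  where
  shrink : ∀ {k} (h : Fin k → Fin (suc m)) → (∀ x → zero ≢ h x) →
           (∀ {x y} → h x ≡ h y → x ≡ y) → (∀ x → P (h x) ≡ true) → k ≤ count (P ∘ suc)
  shrink h avoid injh hith = injective⇒≤count (P ∘ suc) (λ x → punchOut (avoid x))
    (λ eq → injh (Fin.punchOut-injective (avoid _) (avoid _) eq))
    (λ x → trans (cong P (Fin.punchIn-punchOut (avoid x))) (hith x))

  split : Dec (∃ λ x → g x ≡ zero) → suc k ≤ count P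
  split (no g≢0) =
    ℕ.≤-trans (shrink g (λ x 0≡gx → g≢0 (x , sym 0≡gx)) inj hit) (ℕ.m≤n+m _ _)
  split (yes (x₀ , gx₀≡0)) =
    subst (λ b → suc k ≤ indicator b ℕ.+ count (P ∘ suc)) (sym P0≡true)
      (ℕ.s≤s (shrink (g ∘ punchIn x₀) avoid
                     (Fin.punchIn-injective x₀ _ _ ∘ inj) (hit ∘ punchIn x₀)))
    where
    P0≡true : P zero ≡ true
    P0≡true = trans (cong P (sym gx₀≡0)) (hit x₀)
    avoid : ∀ y → zero ≢ g (punchIn x₀ y)
    avoid y 0≡g = Fin.punchInᵢ≢i x₀ y (inj (trans (sym 0≡g) (sym gx₀≡0)))

sumFin-cong : ∀ {m} {f g : Fin m → ℚ} → (∀ k → f k ≡ g k) → sumFin f ≡ sumFin g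
sumFin-cong {zero}  f≗g = refl
sumFin-cong {suc m} f≗g = cong₂ _+_ (f≗g zero) (sumFin-cong (f≗g ∘ suc))

sumFin-zero : ∀ {m} {f : Fin m → ℚ} → (∀ k → f k ≡ 0ℚ) → sumFin f ≡ 0ℚ
sumFin-zero {zero}  f≗0 = refl
sumFin-zero {suc m} f≗0 = cong₂ _+_ (f≗0 zero) (sumFin-zero (f≗0 ∘ suc))

sumFin-linear : ∀ {m} l {f u v : Fin m → ℚ} → (∀ k → f k ≡ l * u k + v k) →
                sumFin f ≡ l * sumFin u + sumFin v
sumFin-linear {zero}  l f≗ = sym (trans (cong (_+ 0ℚ) (ℚ.*-zeroʳ l)) (ℚ.+-identityʳ 0ℚ))
sumFin-linear {suc m} l {f} {u} {v} f≗ = begin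
  f zero + sumFin (f ∘ suc)
    ≡⟨ cong₂ _+_ (f≗ zero) (sumFin-linear l (f≗ ∘ suc)) ⟩
  (l * u zero + v zero) + (l * sumFin (u ∘ suc) + sumFin (v ∘ suc))
    ≡⟨ solve 5 (λ l u₀ v₀ U V → (l :* u₀ :+ v₀) :+ (l :* U :+ V) := l :* (u₀ :+ U) :+ (v₀ :+ V))
         refl l (u zero) (v zero) (sumFin (u ∘ suc)) (sumFin (v ∘ suc)) ⟩
  l * (u zero + sumFin (u ∘ suc)) + (v zero + sumFin (v ∘ suc)) ∎
  where
  open ≡-Reasoning
  open +-*-Solver

sumFin-b2q : ∀ {m} (P : Fin m → Bool) → sumFin (b2q ∘ P) ≡ ℕ→ℚ (count P)
sumFin-b2q {zero}  P = refl
sumFin-b2q {suc m} P = begin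
  b2q (P zero) + sumFin (b2q ∘ P ∘ suc)
    ≡⟨ cong₂ _+_ (b2q≡ℕ→ℚ-indicator (P zero)) (sumFin-b2q (P ∘ suc)) ⟩
  ℕ→ℚ (indicator (P zero)) + ℕ→ℚ (count (P ∘ suc))
    ≡⟨ sym (ℕ→ℚ-+ (indicator (P zero)) (count (P ∘ suc))) ⟩
  ℕ→ℚ (count P) ∎
  where open ≡-Reasoning

infix 4 _≗ₚ_
infix 6 _·_⊕_

_≗ₚ_ : ∀ {m} → Point m → Point m → Set
(xa , xb) ≗ₚ (ya , yb) = (∀ k → xa k ≡ ya k) × (∀ k → xb k ≡ yb k)

0ₚ : ∀ {m} → Point m
0ₚ = (λ _ → 0ℚ) , (λ _ → 0ℚ)

_·_⊕_ : ∀ {m} → ℚ → Point m → Point m → Point m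
l · (ua , ub) ⊕ (ya , yb) = (λ k → l * ua k + ya k) , (λ k → l * ub k + yb k)

record IsLinear {m} (F : Point m → ℚ) : Set where
  field
    zero-at-0ₚ : ∀ {x} → x ≗ₚ 0ₚ → F x ≡ 0ℚ
    linear     : ∀ l {x u y} → x ≗ₚ l · u ⊕ y → F x ≡ l * F u + F y

-- Spelled out as in InPab, so that the coordinate equations of an InPab witness
-- say literally x ≗ₚ combination (incidence ν) cs.
combination : ∀ {m} {T : Set} → (T → Point m) → List (ℚ × T) → Point m
combination v cs = (λ k → sumList (map (λ { (l , t) → l * proj₁ (v t) k }) cs))
                 , (λ k → sumList (map (λ { (l , t) → l * proj₂ (v t) k }) cs))

linear-≤-combination : ∀ {m} {T : Set} {F : Point m → ℚ} → IsLinear F →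
  (v : T → Point m) → ∀ {C} → (∀ t → F (v t) ≤ℚ C) →
  ∀ cs → (∀ {l t} → (l , t) ∈ cs → 0ℚ ≤ℚ l) →
  ∀ {x} → x ≗ₚ combination v cs → F x ≤ℚ sumList (map proj₁ cs) * C
linear-≤-combination {F = F} F-lin v {C} bound [] _ {x} x≗0 = ℚ.≤-reflexive (begin
  F x       ≡⟨ IsLinear.zero-at-0ₚ F-lin x≗0 ⟩
  0ℚ        ≡⟨ sym (ℚ.*-zeroˡ C) ⟩
  0ℚ * C    ∎)
  where open ≡-Reasoning
linear-≤-combination {F = F} F-lin v {C} bound ((l , t) ∷ cs) nonneg {x} x≗ = begin
  F x                                 ≡⟨ IsLinear.linear F-lin l x≗ ⟩
  l * F (v t) + F (combination v cs)
    ≤⟨ ℚ.+-mono-≤ (ℚ.*-monoˡ-≤-nonNeg l {{l≥0}} (bound t))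
                  (linear-≤-combination F-lin v bound cs (nonneg ∘ there) ≗ₚ-refl) ⟩
  l * C + sumList (map proj₁ cs) * C  ≡⟨ sym (ℚ.*-distribʳ-+ C l _) ⟩
  (l + sumList (map proj₁ cs)) * C    ∎
  where
  open ℚ.≤-Reasoning
  l≥0 = ℚ.nonNegative (nonneg (here refl))
  ≗ₚ-refl : combination v cs ≗ₚ combination v cs
  ≗ₚ-refl = (λ _ → refl) , (λ _ → refl)

linear-≤-on-Pab : ∀ {n m} {G : Graph n} {a b β} {ν : Fin m → Fin n} {F : Point m → ℚ} {C} →
  IsLinear F → (∀ S → F (incidence ν S) ≤ℚ C) → ∀ {x} → InPab G a b β ν x → F x ≤ℚ C
linear-≤-on-Pab {ν = ν} {F} {C} F-lin bound {x} (cs , nonneg , Σl≡1 , xa≗ , xb≗) =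
  subst (F x ≤ℚ_) (trans (cong (_* C) Σl≡1) (ℚ.*-identityˡ C))
    (linear-≤-combination F-lin (incidence ν) bound cs nonneg (xa≗ , xb≗))

pathForm : ∀ {m} → Fin m → Fin m → ℚ → Point m → ℚ
pathForm p q A (xa , xb) = sumFin (λ k → xa k + xb k) + (A * xa p + A * xb q)

pathForm-isLinear : ∀ {m} (p q : Fin m) A → IsLinear (pathForm p q A)
pathForm-isLinear p q A = record { zero-at-0ₚ = at-0ₚ ; linear = linear }
  where
  open +-*-Solver

  at-0ₚ : ∀ {x} → x ≗ₚ 0ₚ → pathForm p q A x ≡ 0ℚ
  at-0ₚ {xa , xb} (xa≗0 , xb≗0) = begin
    sumFin (λ k → xa k + xb k) + (A * xa p + A * xb q)
      ≡⟨ cong₂ _+_ (sumFin-zero (λ k → cong₂ _+_ (xa≗0 k) (xb≗0 k)))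
                   (cong₂ _+_ (cong (A *_) (xa≗0 p)) (cong (A *_) (xb≗0 q))) ⟩
    0ℚ + (A * 0ℚ + A * 0ℚ)
      ≡⟨ solve 1 (λ A → con 0ℚ :+ (A :* con 0ℚ :+ A :* con 0ℚ) := con 0ℚ) refl A ⟩
    0ℚ ∎
    where open ≡-Reasoning

  linear : ∀ l {x u y} → x ≗ₚ l · u ⊕ y →
           pathForm p q A x ≡ l * pathForm p q A u + pathForm p q A y
  linear l {xa , xb} {ua , ub} {ya , yb} (xa≗ , xb≗) = begin
    sumFin (λ k → xa k + xb k) + (A * xa p + A * xb q)
      ≡⟨ cong₂ _+_ (sumFin-linear l coordinatewise)
                   (cong₂ _+_ (cong (A *_) (xa≗ p)) (cong (A *_) (xb≗ q))) ⟩
    (l * U + Y) + (A * (l * ua p + ya p) + A * (l * ub q + yb q))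
      ≡⟨ solve 8 (λ l U Y A uₚ yₚ u_q y_q →
                   (l :* U :+ Y) :+ (A :* (l :* uₚ :+ yₚ) :+ A :* (l :* u_q :+ y_q))
                := l :* (U :+ (A :* uₚ :+ A :* u_q)) :+ (Y :+ (A :* yₚ :+ A :* y_q)))
           refl l U Y A (ua p) (ya p) (ub q) (yb q) ⟩
    l * (U + (A * ua p + A * ub q)) + (Y + (A * ya p + A * yb q)) ∎
    where
    open ≡-Reasoning
    U = sumFin (λ k → ua k + ub k)
    Y = sumFin (λ k → ya k + yb k)
    coordinatewise : ∀ k → xa k + xb k ≡ l * (ua k + ub k) + (ya k + yb k)
    coordinatewise k = trans (cong₂ _+_ (xa≗ k) (xb≗ k))
      (solve 5 (λ l a b c d → (l :* a :+ c) :+ (l :* b :+ d) := l :* (a :+ b) :+ (c :+ d))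
         refl l (ua k) (ub k) (ya k) (yb k))

isC : Side → Bool
isC inC = true
isC _   = false

sideIndicators : ∀ {m} → (Fin m → Side) → Point m
sideIndicators s = (λ k → b2q (isA (s k))) , (λ k → b2q (isB (s k)))

pairWeight : ℕ → Side → Side → ℕ
pairWeight α x y = α ℕ.* indicator (isA x) ℕ.+ α ℕ.* indicator (isB y)

pairWeight≤ : ∀ α c x y → (x ≡ inA → y ≡ inB → α ≤ c) → pairWeight α x y ≤ α ℕ.+ c
pairWeight≤ α c inA inB α≤c =
  ℕ.+-mono-≤ (ℕ.≤-reflexive α*1≡α) (ℕ.≤-trans (ℕ.≤-reflexive α*1≡α) (α≤c refl refl))
  where α*1≡α = ℕ.*-identityʳ α
pairWeight≤ α c inA inA _ =
  ℕ.≤-trans (α*indicators≤α α true false ℕ.≤-refl) (ℕ.m≤m+n α c)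
pairWeight≤ α c inA inC _ =
  ℕ.≤-trans (α*indicators≤α α true false ℕ.≤-refl) (ℕ.m≤m+n α c)
pairWeight≤ α c inB y   _ =
  ℕ.≤-trans (α*indicators≤α α false (isB y) (indicator≤1 (isB y))) (ℕ.m≤m+n α c)
pairWeight≤ α c inC y   _ =
  ℕ.≤-trans (α*indicators≤α α false (isB y) (indicator≤1 (isB y))) (ℕ.m≤m+n α c)

count+pairWeight≤ : ∀ {m} (s : Fin m → Side) (p q : Fin m) α →
  (s p ≡ inA → s q ≡ inB → α ≤ count (isC ∘ s)) →
  count (not ∘ isC ∘ s) ℕ.+ pairWeight α (s p) (s q) ≤ m ℕ.+ α
count+pairWeight≤ {m} s p q α crossing = begin
  N ℕ.+ pairWeight α (s p) (s q) ≤⟨ ℕ.+-monoʳ-≤ N (pairWeight≤ α c (s p) (s q) crossing) ⟩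
  N ℕ.+ (α ℕ.+ c)                ≡⟨ cong (N ℕ.+_) (ℕ.+-comm α c) ⟩
  N ℕ.+ (c ℕ.+ α)                ≡⟨ ℕ.+-assoc N c α ⟨
  N ℕ.+ c ℕ.+ α                  ≡⟨ cong (ℕ._+ α) (count-not+count (isC ∘ s)) ⟩
  m ℕ.+ α                        ∎
  where
  open ℕ.≤-Reasoning
  N = count (not ∘ isC ∘ s)
  c = count (isC ∘ s)

pathForm-sideIndicators-≤ : ∀ {m} (s : Fin m → Side) (p q : Fin m) α →
  (s p ≡ inA → s q ≡ inB → α ≤ count (isC ∘ s)) →
  pathForm p q (ℕ→ℚ α) (sideIndicators s) ≤ℚ ℕ→ℚ m + ℕ→ℚ α
pathForm-sideIndicators-≤ {m} s p q α crossing = begin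
  sumFin (λ k → b2q (isA (s k)) + b2q (isB (s k))) + (A * b2q (isA (s p)) + A * b2q (isB (s q)))
    ≡⟨ cong₂ _+_ (trans (sumFin-cong (λ k → A+B≡notC (s k))) (sumFin-b2q (not ∘ isC ∘ s)))
                 (cong₂ _+_ (weight (isA (s p))) (weight (isB (s q)))) ⟩
  ℕ→ℚ N + (ℕ→ℚ wp + ℕ→ℚ wq)
    ≡⟨ trans (ℕ→ℚ-+ N _) (cong (_+_ (ℕ→ℚ N)) (ℕ→ℚ-+ wp wq)) ⟨
  ℕ→ℚ (N ℕ.+ pairWeight α (s p) (s q))
    ≤⟨ ℕ→ℚ-mono-≤ (count+pairWeight≤ s p q α crossing) ⟩
  ℕ→ℚ (m ℕ.+ α)
    ≡⟨ ℕ→ℚ-+ m α ⟩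
  ℕ→ℚ m + ℕ→ℚ α ∎
  where
  open ℚ.≤-Reasoning
  A = ℕ→ℚ α
  N = count (not ∘ isC ∘ s)
  wp = α ℕ.* indicator (isA (s p))
  wq = α ℕ.* indicator (isB (s q))

  A+B≡notC : ∀ x → b2q (isA x) + b2q (isB x) ≡ b2q (not (isC x))
  A+B≡notC inA = refl
  A+B≡notC inB = refl
  A+B≡notC inC = refl

  weight : ∀ b → A * b2q b ≡ ℕ→ℚ (α ℕ.* indicator b)
  weight b = trans (cong (A *_) (b2q≡ℕ→ℚ-indicator b)) (sym (ℕ→ℚ-* α (indicator b)))

chain-crosses-cut : ∀ {V : Set} {R : V → V → Set} (Inside Cut : V → Set) →
  (∀ {x y} → R x y → Inside x → Inside y ⊎ Cut y) →
  ∀ {u v} xs → Inside u → ¬ Inside v → ¬ Cut v →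
  Linked R (u ∷ xs ++ v ∷ []) → ∃ λ w → w ∈ xs × Cut w
chain-crosses-cut Inside Cut step [] u-in v-out v-uncut (uRv ∷ _) =
  ⊥-elim ([ v-out , v-uncut ] (step uRv u-in))
chain-crosses-cut Inside Cut step (y ∷ ys) u-in v-out v-uncut (uRy ∷ chain)
  with step uRy u-in
... | inj₂ y-cut = y , here refl , y-cut
... | inj₁ y-in  with chain-crosses-cut Inside Cut step ys y-in v-out v-uncut chain
...   | w , w∈ys , w-cut = w , there w∈ys , w-cut

separator-closed : ∀ {n} {G : Graph n} {a b β} (S : ABSeparator G a b β) →
  ∀ {x y} → Adj G x y → side S x ≢ inC → side S y ≡ side S x ⊎ side S y ≡ inC
separator-closed {G = G} S {x} {y} xy x∉C with side S x in sx | side S y in sy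
... | inA | inA = inj₁ refl
... | inA | inB = ⊥-elim (noEdge S x y sx sy xy)
... | inA | inC = inj₂ refl
... | inB | inA = ⊥-elim (noEdge S y x sy sx (Graph.sym G xy))
... | inB | inB = inj₁ refl
... | inB | inC = inj₂ refl
... | inC | _   = ⊥-elim (x∉C refl)

data Opposite : Side → Side → Set where
  A-B : Opposite inA inB
  B-A : Opposite inB inA

opposite-∉Cˡ : ∀ {x y} → Opposite x y → x ≢ inC
opposite-∉Cˡ A-B ()
opposite-∉Cˡ B-A ()

opposite-∉Cʳ : ∀ {x y} → Opposite x y → y ≢ inC
opposite-∉Cʳ A-B ()
opposite-∉Cʳ B-A ()

opposite-≢ : ∀ {x y} → Opposite x y → y ≢ x
opposite-≢ A-B ()
opposite-≢ B-A ()

disjointPaths≤cut : ∀ {n m} {G : Graph n} {a b β} {ν : Fin m → Fin n} →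
  (∀ w → w ≢ a → w ≢ b → ∃ λ l → ν l ≡ w) → (S : ABSeparator G a b β) →
  ∀ {u v k} → Opposite (side S u) (side S v) → DisjointPaths G u v k →
  k ≤ count (isC ∘ side S ∘ ν)
disjointPaths≤cut {n} {m} {G = G} {ν = ν} onto S {u} {v} {k} opp (P , disjoint) =
  injective⇒≤count _ index index-injective index-in-C
  where
  Inside Cut : Fin n → Set
  Inside w = side S w ≡ side S u
  Cut    w = side S w ≡ inC

  step : ∀ {x y} → Adj G x y → Inside x → Inside y ⊎ Cut y
  step {x} xy x-in = map₁ (λ y≡x → trans y≡x x-in)
    (separator-closed S xy (λ x∈C → opposite-∉Cˡ opp (trans (sym x-in) x∈C)))

  crossing : ∀ p → ∃ λ w → w ∈ interior (P p) × Cut w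
  crossing p = chain-crosses-cut Inside Cut step (interior (P p))
                 refl (opposite-≢ opp) (opposite-∉Cʳ opp) (chain (P p))

  w : Fin k → Fin n
  w p = proj₁ (crossing p)

  w∉ab : ∀ p {z s} → side S z ≡ s → s ≢ inC → w p ≢ z
  w∉ab p z∈s s∉C refl = s∉C (trans (sym z∈s) (proj₂ (proj₂ (crossing p))))

  numbered : ∀ p → ∃ λ l → ν l ≡ w p
  numbered p = onto (w p) (w∉ab p (a∈A S) (λ ())) (w∉ab p (b∈B S) (λ ()))

  index : Fin k → Fin m
  index p = proj₁ (numbered p)

  index-injective : ∀ {p q} → index p ≡ index q → p ≡ q
  index-injective {p} {q} index-p≡index-q with p Fin.≟ q
  ... | yes p≡q = p≡q
  ... | no  p≢q = ⊥-elim (disjoint p q p≢q (w p) (proj₁ (proj₂ (crossing p)))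
                    (subst (_∈ interior (P q)) wq≡wp (proj₁ (proj₂ (crossing q)))))
    where
    wq≡wp : w q ≡ w p
    wq≡wp = trans (sym (proj₂ (numbered q)))
              (trans (cong ν (sym index-p≡index-q)) (proj₂ (numbered p)))

  index-in-C : ∀ p → (isC ∘ side S ∘ ν) (index p) ≡ true
  index-in-C p = cong isC (trans (cong (side S) (proj₂ (numbered p))) (proj₂ (proj₂ (crossing p))))

pathForm-≤⇒inequality : ∀ {m} (p q : Fin m) A N {xa xb} → pathForm p q A (xa , xb) ≤ℚ N + A →
  (sumFin (λ k → xa k + xb k) - A * (ℕ→ℚ 2 - xa p - xb q)) ≤ℚ (N - A)
pathForm-≤⇒inequality p q A N {xa} {xb} form≤ =
  subst₂ _≤ℚ_ (sym (shift Σx A (xa p) (xb q))) (sym (shift′ N A))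
    (ℚ.+-monoˡ-≤ (- (A + A)) form≤)
  where
  open +-*-Solver
  Σx = sumFin (λ k → xa k + xb k)
  -- ℕ→ℚ 2 computes to 1ℚ + 1ℚ, so this is a ring identity.
  shift : ∀ S A x y → S - A * (ℕ→ℚ 2 - x - y) ≡ S + (A * x + A * y) + - (A + A)
  shift = solve 4 (λ S A x y → S :- A :* ((con 1ℚ :+ con 1ℚ) :- x :- y)
                            := S :+ (A :* x :+ A :* y) :+ :- (A :+ A)) refl
  shift′ : ∀ N A → N - A ≡ N + A + - (A + A)
  shift′ = solve 2 (λ N A → N :- A := N :+ A :+ :- (A :+ A)) refl

mainTheorem3 : (m : ℕ) → 1 ≤ m → (G : Graph (suc (suc m))) → Connected G →
    (a b : Fin (suc (suc m))) → a ≢ b → ¬ Adj G a b →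
    (β : ℕ) → 1 ≤ β → β ≤ suc (suc m) →
    (ν : Fin m → Fin (suc (suc m))) → IsNumbering a b ν →
    (i j : Fin m) → i ≢ j → ¬ Adj G (ν i) (ν j) →
    (α : ℕ) → IsMaxDisjointPaths G (ν i) (ν j) α →
    (xa xb : Fin m → Data.Rational.ℚ) → InPab G a b β ν (xa , xb) →
    ((sumFin (λ k → xa k + xb k) - ℕ→ℚ α * (ℕ→ℚ 2 - xa i - xb j)) ≤ℚ (ℕ→ℚ (suc (suc m)) - ℕ→ℚ α))
    × ((sumFin (λ k → xa k + xb k) - ℕ→ℚ α * (ℕ→ℚ 2 - xa j - xb i)) ≤ℚ (ℕ→ℚ (suc (suc m)) - ℕ→ℚ α))
mainTheorem3 m _ _ _ _ _ _ _ _ _ _ ν (_ , _ , onto) i j _ _ α (paths , _) xa xb x∈Pab =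
    valid i j (λ S iA jB → disjointPaths≤cut onto S (subst₂ Opposite (sym iA) (sym jB) A-B) paths)
  , valid j i (λ S jA iB → disjointPaths≤cut onto S (subst₂ Opposite (sym iB) (sym jA) B-A) paths)
  where
  A = ℕ→ℚ α
  valid : ∀ p q →
    (∀ S → side S (ν p) ≡ inA → side S (ν q) ≡ inB → α ≤ count (isC ∘ side S ∘ ν)) →
    (sumFin (λ k → xa k + xb k) - A * (ℕ→ℚ 2 - xa p - xb q)) ≤ℚ (ℕ→ℚ (suc (suc m)) - A)
  valid p q crossing = pathForm-≤⇒inequality p q A (ℕ→ℚ (suc (suc m))) {xa} {xb}
    (linear-≤-on-Pab (pathForm-isLinear p q A) vertex-bound x∈Pab)
    where
    vertex-bound : ∀ S → pathForm p q A (incidence ν S) ≤ℚ ℕ→ℚ (suc (suc m)) + A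
    vertex-bound S = ℚ.≤-trans (pathForm-sideIndicators-≤ (side S ∘ ν) p q α (crossing S))
                       (ℚ.+-monoˡ-≤ A (ℕ→ℚ-mono-≤ (ℕ.m≤n+m m 2)))
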